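{- Let $m\le 0$ be an integer. The ordinary generating function, with respect to length, of partial GDAP (including the empty path) that never go below the line $y=m$ is $$\frac{r_2^{ -m}-r_2^{ -1-m}-x^2}{x^3},\qquad\text{where } r_2=\frac{1+x-x^2-\sqrt{x^4-2x^3-x^2-2x+1}}{2x}.$$
   Context: A grand Dyck path with air pockets (GDAP) is a lattice path in $\mathbb{Z}^2$ starting at $(0,0)$ and ending on the $x$-axis, consisting of up-steps $U=(1,1)$ and down-steps $D_k=(1,-k)$ with $k\ge 1$, such that no two down-steps are consecutive; the path may go below the $x$-axis, and the empty path is a GDAP. A partial GDAP is a prefix (possibly empty, possibly the whole path) of a GDAP. "Never goes below the line $y=m$" means every vertex of the path has ordinate $\ge m$. The length of a path is its number of steps. The square root is the formal power series with constant term $1$, so $r_2$ is a formal power series with constant term $1$ (and hence invertible). -}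

module Defs where

open import Data.Nat as ℕ using (ℕ; zero; suc; _∸_)
open import Data.Integer as ℤ using (ℤ; +_; -[1+_])
open import Data.Rational as ℚ using (ℚ; 0ℚ; 1ℚ; ½)
open import Data.List using (List; []; _∷_; _++_; length; [_])
open import Data.List.Relation.Unary.All using (All)
open import Data.List.Relation.Unary.Unique.Propositional using (Unique)
open import Data.List.Membership.Propositional using (_∈_)
open import Data.Product using (Σ; _×_)
open import Data.Unit using (⊤)
open import Data.Empty using (⊥)
open import Relation.Binary.PropositionalEquality using (_≡_)

-- U = (1,1) ;  D k = (1,-k)  (a genuine down-step requires k ≥ 1)
data Step : Set where
  U : Step
  D : ℕ → Step

ValidStep : Step → Set
ValidStep U     = ⊤
ValidStep (D k) = 1 ℕ.≤ k

δ : Step → ℤ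
δ U     = + 1
δ (D k) = ℤ.- (+ k)

height : List Step → ℤ
height []      = + 0
height (s ∷ p) = δ s ℤ.+ height p

NoConsecDown : List Step → Set
NoConsecDown []              = ⊤
NoConsecDown (U ∷ p)         = NoConsecDown p
NoConsecDown (D k ∷ [])      = ⊤
NoConsecDown (D k ∷ U ∷ p)   = NoConsecDown (U ∷ p)
NoConsecDown (D k ∷ D j ∷ p) = ⊥

IsGDAP : List Step → Set
IsGDAP q = All ValidStep q × NoConsecDown q × height q ≡ + 0

IsPartialGDAP : List Step → Set
IsPartialGDAP p = Σ (List Step) (λ q → IsGDAP (p ++ q))

NeverBelowFrom : ℤ → ℤ → List Step → Set
NeverBelowFrom m h []      = m ℤ.≤ h
NeverBelowFrom m h (s ∷ p) = m ℤ.≤ h × NeverBelowFrom m (h ℤ.+ δ s) p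

NeverBelow : ℤ → List Step → Set
NeverBelow m p = NeverBelowFrom m (+ 0) p

HasCard : {A : Set} → (A → Set) → ℕ → Set
HasCard {A} P c =
  Σ (List A) (λ L → Unique L × ((x : A) → (x ∈ L → P x) × (P x → x ∈ L)) × length L ≡ c)

Series : Set
Series = ℕ → ℚ

sumTo : ℕ → (ℕ → ℚ) → ℚ
sumTo zero    f = 0ℚ
sumTo (suc n) f = f n ℚ.+ sumTo n f

lookupD : List ℚ → ℕ → ℚ
lookupD []      _       = 0ℚ
lookupD (a ∷ l) zero    = a
lookupD (a ∷ l) (suc i) = lookupD l i

oneS : Series
oneS zero    = 1ℚ
oneS (suc _) = 0ℚ

_⊕_ : Series → Series → Series
(f ⊕ g) n = f n ℚ.+ g n

_⊖_ : Series → Series → Series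
(f ⊖ g) n = f n ℚ.- g n

_⊛_ : Series → Series → Series
(f ⊛ g) n = sumTo (suc n) (λ i → f i ℚ.* g (n ∸ i))

pow : Series → ℕ → Series
pow f zero    = oneS
pow f (suc k) = f ⊛ pow f k

x² : Series
x² 2 = 1ℚ
x² _ = 0ℚ

-- Square root of a series with constant term 1: the unique series s with
-- s 0 = 1 and s ⊛ s = p, computed by the recursion
--   2 s_{n+1} = p_{n+1} - Σ_{i=1}^{n} s_i s_{n+1-i}.
sqrtList : Series → ℕ → List ℚ
sqrtList p zero    = [ 1ℚ ]
sqrtList p (suc n) =
  let prev = sqrtList p n
      s    = lookupD prev
  in prev ++ [ ½ ℚ.* (p (suc n) ℚ.- sumTo n (λ i → s (suc i) ℚ.* s (n ∸ i))) ]

sqrtS : Series → Series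
sqrtS p n = lookupD (sqrtList p n) n

-- Multiplicative inverse of a series with constant term 1:
--   b_0 = 1,  b_{n+1} = - Σ_{i=1}^{n+1} f_i b_{n+1-i}.
invList : Series → ℕ → List ℚ
invList f zero    = [ 1ℚ ]
invList f (suc n) =
  let prev = invList f n
      b    = lookupD prev
  in prev ++ [ ℚ.- sumTo (suc n) (λ i → f (suc i) ℚ.* b (n ∸ i)) ]

inv1 : Series → Series
inv1 f n = lookupD (invList f n) n

-- r₂ = (1 + x - x² - √(x⁴ - 2x³ - x² - 2x + 1)) / (2x)

discr : Series
discr 0 = 1ℚ
discr 1 = ℚ.- (+ 2 ℚ./ 1)
discr 2 = ℚ.- 1ℚ
discr 3 = ℚ.- (+ 2 ℚ./ 1)
discr 4 = 1ℚ
discr _ = 0ℚ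

numPoly : Series
numPoly 0 = 1ℚ
numPoly 1 = 1ℚ
numPoly 2 = ℚ.- 1ℚ
numPoly _ = 0ℚ

-- division by 2x: the numerator has constant term 1 - 1 = 0
r₂ : Series
r₂ n = ½ ℚ.* (numPoly (suc n) ℚ.- sqrtS discr (suc n))

-- integer powers of r₂ (r₂ has constant term 1, hence is invertible)
r₂^ : ℤ → Series
r₂^ (+ k)      = pow r₂ k
r₂^ -[1+ j ]   = pow (inv1 r₂) (suc j)

numer : ℤ → Series
numer m = (r₂^ (ℤ.- m) ⊖ r₂^ (ℤ.- (+ 1 ℤ.+ m))) ⊖ x²

ℕtoℚ : ℕ → ℚ
ℕtoℚ c = + c ℚ./ 1

-- Write r for r₂, P = 1 + x − x² and Δ = x⁴ − 2x³ − x² − 2x + 1 = P² − 4x.  Since 2xr = P − √Δ,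
-- squaring gives the quadratic equation 1 − P r + x r² = 0.  For m = −j the numerator is
-- N_j = r^j − r^(j−1) − x², and the quadratic equation turns into N_j = x M_j + x² (r^j − 1) with
-- M_j = r^(j+1) − r^j, while r^j − 1 telescopes to Σ_{i<j} M_i.  Hence the coefficients
-- [x^(n+3)] N_j and [x^(n+2)] M_j obey a recursion in n, with M_j = N_(j+1) + x².
--
-- On the path side, every path with admissible steps and no two consecutive down steps extends
-- to a GDAP, so the paths to count are the walks from height j that stay at height ≥ 0.  Such a
-- walk of length n + 1 is U followed by a walk from j + 1, or D_(j−i) followed by a walk from
-- some i < j that does not start with a down step, i.e. starts with U.  The numbers of walks of
-- length n from j, with and without that restriction, satisfy the same recursion as the two
-- families of coefficients, and start at the same values.
module Submission where

open import Defs
open import Data.Nat using (ℕ)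
open import Data.Integer using (ℤ; +_; _≤_)
open import Data.Rational using (ℚ; 0ℚ)
open import Data.List using (List; length)
open import Data.Product using (Σ; _×_)
open import Relation.Binary.PropositionalEquality using (_≡_)

open import Algebra.Bundles using (CommutativeRing; CommutativeMonoid)
import Algebra.Consequences.Setoid as Consequences
import Algebra.Construct.Pointwise as Pointwise
import Algebra.Solver.Ring as RingSolver
open import Algebra.Solver.Ring.AlmostCommutativeRing
  using (AlmostCommutativeRing; fromCommutativeRing; _-Raw-AlmostCommutative⟶_)
open import Algebra.Structures using (IsCommutativeRing; IsAbelianGroup)
open import Data.Bool using (Bool; true; false)
open import Data.Empty using (⊥)
open import Data.Integer using (-[1+_]; +≤+; +<+)
import Data.Integer as ℤ
import Data.Integer.Properties as ℤ
open import Data.List using ([]; _∷_; _++_; [_]; map; replicate)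
open import Data.List.Membership.Propositional using (_∈_)
open import Data.List.Membership.Propositional.Properties using (∈-map⁺; ∈-map⁻; ∈-++⁺ˡ; ∈-++⁺ʳ; ∈-++⁻)
open import Data.List.Properties using (∷-injectiveˡ; ∷-injectiveʳ; length-map; length-++)
open import Data.List.Relation.Unary.All using (All; []; _∷_)
import Data.List.Relation.Unary.All.Properties as All
open import Data.List.Relation.Unary.AllPairs using ([]; _∷_)
open import Data.List.Relation.Unary.Any using (here)
open import Data.List.Relation.Unary.Unique.Propositional using (Unique)
import Data.List.Relation.Unary.Unique.Propositional.Properties as Unique
open import Data.Maybe using (Maybe; just; nothing)
open import Data.Nat as ℕ using (zero; suc; _∸_; z≤n; s≤s)
import Data.Nat.Coprimality as Coprime
import Data.Nat.Properties as ℕ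
open import Data.Product using (_,_; proj₁; proj₂)
import Data.Rational as ℚ
open import Data.Rational using (1ℚ; ½; _+_; _*_; -_; _-_)
open import Data.Rational.Properties
  using (normalize-coprime; +-comm; +-assoc; +-identityˡ; +-identityʳ; +-inverseʳ; *-assoc; *-comm;
         *-identityˡ; *-zeroˡ; *-zeroʳ; *-distribˡ-+; *-distribʳ-+; +-0-isAbelianGroup; +-0-commutativeMonoid)
open import Data.Rational.Solver using (module +-*-Solver)
open import Algebra.Properties.CommutativeSemigroup
  (CommutativeMonoid.commutativeSemigroup +-0-commutativeMonoid) using (interchange)
open import Data.Sum using (inj₁; inj₂)
open import Data.Unit using (⊤; tt)
open import Function using (_∘_; _∘′_; id; const)
open import Level using (0ℓ)
open import Relation.Binary.Bundles using (Setoid)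
open import Relation.Binary.PropositionalEquality
  using (_≗_; refl; sym; trans; cong; cong₂; subst; module ≡-Reasoning)
open import Relation.Nullary using (yes; no; contradiction)

-- Finite sums and the ring of formal power series
sumTo-cong : ∀ n {f g : ℕ → ℚ} → (∀ i → i ℕ.< n → f i ≡ g i) → sumTo n f ≡ sumTo n g
sumTo-cong zero    f≡g = refl
sumTo-cong (suc n) f≡g = cong₂ _+_ (f≡g n ℕ.≤-refl) (sumTo-cong n (λ i i<n → f≡g i (ℕ.m≤n⇒m≤1+n i<n)))

sumTo-reindex-suc : ∀ n (f : ℕ → ℚ) → sumTo (suc n) f ≡ sumTo n (f ∘ suc) + f 0
sumTo-reindex-suc zero    f = trans (+-identityʳ (f 0)) (sym (+-identityˡ (f 0)))
sumTo-reindex-suc (suc n) f = trans (cong (_+_ (f (suc n))) (sumTo-reindex-suc n f)) (sym (+-assoc (f (suc n)) _ (f 0)))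

sumTo-+ : ∀ n (f g : ℕ → ℚ) → sumTo n (λ i → f i + g i) ≡ sumTo n f + sumTo n g
sumTo-+ zero    f g = refl
sumTo-+ (suc n) f g =
  trans (cong (_+_ (f n + g n)) (sumTo-+ n f g)) (interchange (f n) (g n) (sumTo n f) (sumTo n g))

sumTo-*ˡ : ∀ n c (f : ℕ → ℚ) → sumTo n (λ i → c * f i) ≡ c * sumTo n f
sumTo-*ˡ zero    c f = sym (*-zeroʳ c)
sumTo-*ˡ (suc n) c f = trans (cong (_+_ (c * f n)) (sumTo-*ˡ n c f)) (sym (*-distribˡ-+ c (f n) _))

sumTo-0 : ∀ n → sumTo n (const 0ℚ) ≡ 0ℚ
sumTo-0 zero    = refl
sumTo-0 (suc n) = trans (+-identityˡ _) (sumTo-0 n)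

sumTo-reverse : ∀ n (f : ℕ → ℚ) → sumTo n f ≡ sumTo n (λ i → f (n ∸ suc i))
sumTo-reverse zero    f = refl
sumTo-reverse (suc n) f = begin
  f n + sumTo n f                        ≡⟨ cong (_+_ (f n)) (sumTo-reverse n f) ⟩
  f n + sumTo n (λ i → f (n ∸ suc i))    ≡⟨ +-comm (f n) _ ⟩
  sumTo n (λ i → f (n ∸ suc i)) + f n    ≡⟨ sumTo-reindex-suc n (λ i → f (n ∸ i)) ⟨
  sumTo (suc n) (λ i → f (n ∸ i))        ∎
  where open ≡-Reasoning

⊛-cong : ∀ {f f′ g g′} → f ≗ f′ → g ≗ g′ → f ⊛ g ≗ f′ ⊛ g′
⊛-cong f≗f′ g≗g′ n = sumTo-cong (suc n) (λ i _ → cong₂ _*_ (f≗f′ i) (g≗g′ (n ∸ i)))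

⊛-zero : ∀ f g → (f ⊛ g) 0 ≡ f 0 * g 0
⊛-zero f g = +-identityʳ _

⊛-suc : ∀ f g → (f ⊛ g) ∘ suc ≗ (λ i → f 0 * g (suc i)) ⊕ ((f ∘ suc) ⊛ g)
⊛-suc f g n =
  trans (sumTo-reindex-suc (suc n) (λ i → f i * g (suc n ∸ i))) (+-comm (((f ∘ suc) ⊛ g) n) (f 0 * g (suc n)))

⊛-comm : ∀ f g → f ⊛ g ≗ g ⊛ f
⊛-comm f g n = trans (sumTo-reverse (suc n) (λ i → f i * g (n ∸ i))) (sumTo-cong (suc n) swap)
  where
  swap : ∀ i → i ℕ.< suc n → f (n ∸ i) * g (n ∸ (n ∸ i)) ≡ g i * f (n ∸ i)
  swap i i≤n = trans (cong (λ k → f (n ∸ i) * g k) (ℕ.m∸[m∸n]≡n (ℕ.≤-pred i≤n))) (*-comm (f (n ∸ i)) (g i))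

⊛-distribʳ-⊕ : ∀ h f g → (f ⊕ g) ⊛ h ≗ (f ⊛ h) ⊕ (g ⊛ h)
⊛-distribʳ-⊕ h f g n = trans (sumTo-cong (suc n) (λ i _ → *-distribʳ-+ (h (n ∸ i)) (f i) (g i)))
  (sumTo-+ (suc n) (λ i → f i * h (n ∸ i)) (λ i → g i * h (n ∸ i)))

⊛-scaleˡ : ∀ c f g n → ((λ i → c * f i) ⊛ g) n ≡ c * (f ⊛ g) n
⊛-scaleˡ c f g n = trans (sumTo-cong (suc n) (λ i _ → *-assoc c (f i) (g (n ∸ i)))) (sumTo-*ˡ (suc n) c _)

⊛-assoc : ∀ f g h → (f ⊛ g) ⊛ h ≗ f ⊛ (g ⊛ h)
⊛-assoc f g h zero    = begin
  ((f ⊛ g) ⊛ h) 0        ≡⟨ ⊛-zero (f ⊛ g) h ⟩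
  (f ⊛ g) 0 * h 0        ≡⟨ cong (_* h 0) (⊛-zero f g) ⟩
  f 0 * g 0 * h 0        ≡⟨ *-assoc (f 0) (g 0) (h 0) ⟩
  f 0 * (g 0 * h 0)      ≡⟨ cong (f 0 *_) (⊛-zero g h) ⟨
  f 0 * (g ⊛ h) 0        ≡⟨ ⊛-zero f (g ⊛ h) ⟨
  (f ⊛ (g ⊛ h)) 0        ∎
  where open ≡-Reasoning
⊛-assoc f g h (suc n) = begin
  ((f ⊛ g) ⊛ h) (suc n)
    ≡⟨ ⊛-suc (f ⊛ g) h n ⟩
  (f ⊛ g) 0 * h (suc n) + (((f ⊛ g) ∘ suc) ⊛ h) n
    ≡⟨ cong₂ _+_ (cong (_* h (suc n)) (⊛-zero f g)) (⊛-cong {g = h} (⊛-suc f g) (λ _ → refl) n) ⟩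
  f 0 * g 0 * h (suc n) + (((λ i → f 0 * g (suc i)) ⊕ ((f ∘ suc) ⊛ g)) ⊛ h) n
    ≡⟨ cong (_+_ (f 0 * g 0 * h (suc n))) (trans (⊛-distribʳ-⊕ h (λ i → f 0 * g (suc i)) ((f ∘ suc) ⊛ g) n)
         (cong₂ _+_ (⊛-scaleˡ (f 0) (g ∘ suc) h n) (⊛-assoc (f ∘ suc) g h n))) ⟩
  f 0 * g 0 * h (suc n) + (f 0 * ((g ∘ suc) ⊛ h) n + ((f ∘ suc) ⊛ (g ⊛ h)) n)
    ≡⟨ solve 5 (λ a b c t u → a :* b :* c :+ (a :* t :+ u) := a :* (b :* c :+ t) :+ u) refl
         (f 0) (g 0) (h (suc n)) (((g ∘ suc) ⊛ h) n) (((f ∘ suc) ⊛ (g ⊛ h)) n) ⟩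
  f 0 * (g 0 * h (suc n) + ((g ∘ suc) ⊛ h) n) + ((f ∘ suc) ⊛ (g ⊛ h)) n
    ≡⟨ cong (λ z → f 0 * z + ((f ∘ suc) ⊛ (g ⊛ h)) n) (⊛-suc g h n) ⟨
  f 0 * (g ⊛ h) (suc n) + ((f ∘ suc) ⊛ (g ⊛ h)) n
    ≡⟨ ⊛-suc f (g ⊛ h) n ⟨
  (f ⊛ (g ⊛ h)) (suc n) ∎
  where
  open ≡-Reasoning
  open +-*-Solver

⊛-zeroˡ : ∀ f → const 0ℚ ⊛ f ≗ const 0ℚ
⊛-zeroˡ f n = trans (sumTo-cong (suc n) (λ i _ → *-zeroˡ (f (n ∸ i)))) (sumTo-0 (suc n))

⊛-zeroʳ : ∀ f → f ⊛ const 0ℚ ≗ const 0ℚ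
⊛-zeroʳ f n = trans (⊛-comm f (const 0ℚ) n) (⊛-zeroˡ f n)

⊛-identityˡ : ∀ f → oneS ⊛ f ≗ f
⊛-identityˡ f zero    = trans (⊛-zero oneS f) (*-identityˡ (f 0))
⊛-identityˡ f (suc n) = begin
  (oneS ⊛ f) (suc n)                          ≡⟨ ⊛-suc oneS f n ⟩
  1ℚ * f (suc n) + ((oneS ∘ suc) ⊛ f) n       ≡⟨ cong₂ _+_ (*-identityˡ (f (suc n))) (⊛-zeroˡ f n) ⟩
  f (suc n) + 0ℚ                              ≡⟨ +-identityʳ _ ⟩
  f (suc n)                                   ∎
  where open ≡-Reasoning

⊛-identityʳ : ∀ f → f ⊛ oneS ≗ f
⊛-identityʳ f n = trans (⊛-comm f oneS n) (⊛-identityˡ f n)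

⊕-isAbelianGroup : IsAbelianGroup _≗_ _⊕_ (const 0ℚ) (-_ ∘′_)
⊕-isAbelianGroup = Pointwise.isAbelianGroup ℕ +-0-isAbelianGroup

series-setoid : Setoid 0ℓ 0ℓ
series-setoid = IsAbelianGroup.setoid ⊕-isAbelianGroup

⊛-+-isCommutativeRing : IsCommutativeRing _≗_ _⊕_ _⊛_ (-_ ∘′_) (const 0ℚ) oneS
⊛-+-isCommutativeRing = record
  { isRing = record
    { +-isAbelianGroup = ⊕-isAbelianGroup
    ; *-cong           = ⊛-cong
    ; *-assoc          = ⊛-assoc
    ; *-identity       = ⊛-identityˡ , ⊛-identityʳ
    ; distrib          = comm∧distrʳ⇒distr (IsAbelianGroup.∙-cong ⊕-isAbelianGroup) ⊛-comm ⊛-distribʳ-⊕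
    }
  ; *-comm = ⊛-comm
  }
  where open Consequences series-setoid

⊛-+-commutativeRing : CommutativeRing 0ℓ 0ℓ
⊛-+-commutativeRing = record { isCommutativeRing = ⊛-+-isCommutativeRing }

constS : ℚ → Series
constS c zero    = c
constS c (suc _) = 0ℚ

constS-1ℚ : constS 1ℚ ≗ oneS
constS-1ℚ zero    = refl
constS-1ℚ (suc n) = refl

constS-⊛ : ∀ a b → constS (a * b) ≗ constS a ⊛ constS b
constS-⊛ a b zero    = sym (⊛-zero (constS a) (constS b))
constS-⊛ a b (suc n) = sym (begin
  (constS a ⊛ constS b) (suc n)                 ≡⟨ ⊛-suc (constS a) (constS b) n ⟩
  a * 0ℚ + ((constS a ∘ suc) ⊛ constS b) n      ≡⟨ cong₂ _+_ (*-zeroʳ a) (⊛-zeroˡ (constS b) n) ⟩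
  0ℚ + 0ℚ                                       ≡⟨⟩
  0ℚ                                            ∎)
  where open ≡-Reasoning

series-almostCommutativeRing : AlmostCommutativeRing 0ℓ 0ℓ
series-almostCommutativeRing = fromCommutativeRing ⊛-+-commutativeRing

constS-morphism : ℚ.+-*-rawRing -Raw-AlmostCommutative⟶ series-almostCommutativeRing
constS-morphism = record
  { ⟦_⟧    = constS
  ; +-homo = λ { a b zero → refl ; a b (suc n) → refl }
  ; *-homo = constS-⊛
  ; -‿homo = λ { a zero → refl ; a (suc n) → refl }
  ; 0-homo = λ { zero → refl ; (suc n) → refl }
  ; 1-homo = λ { zero → refl ; (suc n) → refl }
  }

constS-≟ : ∀ a b → Maybe (constS a ≗ constS b)
constS-≟ a b with a ℚ.≟ b
... | yes refl = just (λ _ → refl)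
... | no  _    = nothing

module SeriesSolver = RingSolver ℚ.+-*-rawRing series-almostCommutativeRing constS-morphism constS-≟

shift : Series → Series
shift f zero    = 0ℚ
shift f (suc n) = f n

shift-cong : ∀ {f g} → f ≗ g → shift f ≗ shift g
shift-cong f≗g zero    = refl
shift-cong f≗g (suc n) = f≗g n

x : Series
x = shift oneS

x-⊛ : ∀ f → x ⊛ f ≗ shift f
x-⊛ f zero    = trans (⊛-zero x f) (*-zeroˡ (f 0))
x-⊛ f (suc n) = begin
  (x ⊛ f) (suc n)                   ≡⟨ ⊛-suc x f n ⟩
  0ℚ * f (suc n) + (oneS ⊛ f) n     ≡⟨ cong₂ _+_ (*-zeroˡ (f (suc n))) (⊛-identityˡ f n) ⟩
  0ℚ + f n                          ≡⟨ +-identityˡ (f n) ⟩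
  f n                               ∎
  where open ≡-Reasoning

x³-shift : x ⊛ (x ⊛ x) ≗ shift (shift x)
x³-shift n = trans (x-⊛ (x ⊛ x) n) (shift-cong (x-⊛ x) n)

x⁴-shift : x ⊛ (x ⊛ (x ⊛ x)) ≗ shift (shift (shift x))
x⁴-shift n = trans (x-⊛ (x ⊛ (x ⊛ x)) n) (shift-cong x³-shift n)

x²-≗ : x² ≗ x ⊛ x
x²-≗ n = trans (by-shifts n) (sym (x-⊛ x n))
  where
  by-shifts : x² ≗ shift x
  by-shifts 0 = refl
  by-shifts 1 = refl
  by-shifts 2 = refl
  by-shifts (suc (suc (suc n))) = refl

pow-constant : ∀ f → f 0 ≡ 1ℚ → ∀ j → pow f j 0 ≡ 1ℚ
pow-constant f f₀≡1 zero    = refl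
pow-constant f f₀≡1 (suc j) = begin
  (f ⊛ pow f j) 0     ≡⟨ ⊛-zero f (pow f j) ⟩
  f 0 * pow f j 0     ≡⟨ cong₂ _*_ f₀≡1 (pow-constant f f₀≡1 j) ⟩
  1ℚ * 1ℚ             ≡⟨⟩
  1ℚ                  ∎
  where open ≡-Reasoning

-- Square roots and inverses
lookupD-++-< : ∀ (l : List ℚ) a {i} → i ℕ.< length l → lookupD (l ++ [ a ]) i ≡ lookupD l i
lookupD-++-< (b ∷ l) a {zero}  _         = refl
lookupD-++-< (b ∷ l) a {suc i} (s≤s i<l) = lookupD-++-< l a i<l

lookupD-++-length : ∀ (l : List ℚ) a → lookupD (l ++ [ a ]) (length l) ≡ a
lookupD-++-length []      a = refl
lookupD-++-length (b ∷ l) a = lookupD-++-length l a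

module SnocRecursion
  (L : ℕ → List ℚ) (step : ℕ → (ℕ → ℚ) → ℚ)
  (length-L-zero : length (L 0) ≡ 1)
  (L-suc : ∀ n → L (suc n) ≡ L n ++ [ step n (lookupD (L n)) ])
  (step-cong : ∀ n {f g} → (∀ i → i ℕ.≤ n → f i ≡ g i) → step n f ≡ step n g)
  where

  diagonal : ℕ → ℚ
  diagonal n = lookupD (L n) n

  length-L : ∀ n → length (L n) ≡ suc n
  length-L zero    = length-L-zero
  length-L (suc n) = begin
    length (L (suc n))                          ≡⟨ cong length (L-suc n) ⟩
    length (L n ++ [ step n (lookupD (L n)) ])  ≡⟨ length-++ (L n) ⟩
    length (L n) ℕ.+ 1                          ≡⟨ cong (ℕ._+ 1) (length-L n) ⟩
    suc n ℕ.+ 1                                 ≡⟨ ℕ.+-comm (suc n) 1 ⟩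
    suc (suc n)                                 ∎
    where open ≡-Reasoning

  lookupD-L : ∀ n i → i ℕ.≤ n → lookupD (L n) i ≡ diagonal i
  lookupD-L zero    zero    z≤n = refl
  lookupD-L (suc n) i       i≤1+n with ℕ.m≤n⇒m<n∨m≡n i≤1+n
  ... | inj₂ refl      = refl
  ... | inj₁ (s≤s i≤n) = begin
    lookupD (L (suc n)) i
      ≡⟨ cong (λ l → lookupD l i) (L-suc n) ⟩
    lookupD (L n ++ [ step n (lookupD (L n)) ]) i
      ≡⟨ lookupD-++-< (L n) _ (subst (i ℕ.<_) (sym (length-L n)) (s≤s i≤n)) ⟩
    lookupD (L n) i
      ≡⟨ lookupD-L n i i≤n ⟩
    diagonal i
      ∎
    where open ≡-Reasoning

  diagonal-suc : ∀ n → diagonal (suc n) ≡ step n diagonal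
  diagonal-suc n = begin
    lookupD (L (suc n)) (suc n)                                 ≡⟨ cong (λ l → lookupD l (suc n)) (L-suc n) ⟩
    lookupD (L n ++ [ step n (lookupD (L n)) ]) (suc n)         ≡⟨ cong (lookupD (L n ++ _)) (length-L n) ⟨
    lookupD (L n ++ [ step n (lookupD (L n)) ]) (length (L n))  ≡⟨ lookupD-++-length (L n) _ ⟩
    step n (lookupD (L n))                                      ≡⟨ step-cong n (lookupD-L n) ⟩
    step n diagonal                                             ∎
    where open ≡-Reasoning

sqrtS-suc : ∀ p n → sqrtS p (suc n) ≡ ½ * (p (suc n) - sumTo n (λ i → sqrtS p (suc i) * sqrtS p (n ∸ i)))
sqrtS-suc p = diagonal-suc
  where
  step : ℕ → (ℕ → ℚ) → ℚ
  step n s = ½ * (p (suc n) - sumTo n (λ i → s (suc i) * s (n ∸ i)))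

  step-cong : ∀ n {f g} → (∀ i → i ℕ.≤ n → f i ≡ g i) → step n f ≡ step n g
  step-cong n f≡g = cong (λ z → ½ * (p (suc n) - z)) (sumTo-cong n (λ i i<n →
    cong₂ _*_ (f≡g (suc i) i<n) (f≡g (n ∸ i) (ℕ.m∸n≤m n i))))

  open SnocRecursion (sqrtList p) step refl (λ _ → refl) step-cong

sqrtS-⊛ : ∀ p → p 0 ≡ 1ℚ → sqrtS p ⊛ sqrtS p ≗ p
sqrtS-⊛ p p₀≡1 zero    = sym p₀≡1
sqrtS-⊛ p p₀≡1 (suc n) = begin
  (s ⊛ s) (suc n)
    ≡⟨ ⊛-suc s s n ⟩
  1ℚ * s (suc n) + (s (suc n) * s (n ∸ n) + S)
    ≡⟨ cong (λ k → 1ℚ * s (suc n) + (s (suc n) * s k + S)) (ℕ.n∸n≡0 n) ⟩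
  1ℚ * s (suc n) + (s (suc n) * 1ℚ + S)
    ≡⟨ solve 2 (λ a b → con 1ℚ :* a :+ (a :* con 1ℚ :+ b) := (a :+ a) :+ b) refl (s (suc n)) S ⟩
  s (suc n) + s (suc n) + S
    ≡⟨ cong (λ z → z + z + S) (sqrtS-suc p n) ⟩
  ½ * (p (suc n) - S) + ½ * (p (suc n) - S) + S
    ≡⟨ solve 2 (λ a b → con ½ :* (a :- b) :+ con ½ :* (a :- b) :+ b := a) refl (p (suc n)) S ⟩
  p (suc n)
    ∎
  where
  open ≡-Reasoning
  open +-*-Solver
  s = sqrtS p
  S = sumTo n (λ i → s (suc i) * s (n ∸ i))

inv1-suc : ∀ f n → inv1 f (suc n) ≡ - ((f ∘ suc) ⊛ inv1 f) n
inv1-suc f = diagonal-suc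
  where
  step : ℕ → (ℕ → ℚ) → ℚ
  step n b = - sumTo (suc n) (λ i → f (suc i) * b (n ∸ i))

  step-cong : ∀ n {b c} → (∀ i → i ℕ.≤ n → b i ≡ c i) → step n b ≡ step n c
  step-cong n b≡c = cong -_ (sumTo-cong (suc n) (λ i _ → cong (f (suc i) *_) (b≡c (n ∸ i) (ℕ.m∸n≤m n i))))

  open SnocRecursion (invList f) step refl (λ _ → refl) step-cong

⊛-inv1 : ∀ f → f 0 ≡ 1ℚ → f ⊛ inv1 f ≗ oneS
⊛-inv1 f f₀≡1 zero    = trans (⊛-zero f (inv1 f)) (cong (_* 1ℚ) f₀≡1)
⊛-inv1 f f₀≡1 (suc n) = begin
  (f ⊛ inv1 f) (suc n)                    ≡⟨ ⊛-suc f (inv1 f) n ⟩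
  f 0 * inv1 f (suc n) + S                ≡⟨ cong₂ (λ a b → a * b + S) f₀≡1 (inv1-suc f n) ⟩
  1ℚ * - S + S                            ≡⟨ solve 1 (λ a → con 1ℚ :* (:- a) :+ a := con 0ℚ) refl S ⟩
  0ℚ                                      ∎
  where
  open ≡-Reasoning
  open +-*-Solver
  S = ((f ∘ suc) ⊛ inv1 f) n

-- The quadratic equation of r₂ and the recurrence for the numerators
P : Series → Series
P y = constS 1ℚ ⊕ (y ⊖ (y ⊛ y))

Δ : Series → Series
Δ y = (((constS 1ℚ ⊖ (y ⊕ y)) ⊖ (y ⊛ y)) ⊖ ((y ⊛ (y ⊛ y)) ⊕ (y ⊛ (y ⊛ y)))) ⊕ (y ⊛ (y ⊛ (y ⊛ y)))

Q : Series → Series → Series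
Q y r = (constS 1ℚ ⊖ (P y ⊛ r)) ⊕ (y ⊛ (r ⊛ r))

W : Series → Series → Series
W y r = ((constS 1ℚ ⊖ (y ⊛ r)) ⊕ y) ⊖ (y ⊛ y)

-- Because P² − Δ = 4y.
quadratic-discriminant : ∀ y r →
  y ⊛ ((Q y r ⊕ Q y r) ⊕ (Q y r ⊕ Q y r)) ≗ ((P y ⊖ (y ⊛ (r ⊕ r))) ⊛ (P y ⊖ (y ⊛ (r ⊕ r)))) ⊖ Δ y
quadratic-discriminant = solve 2 (λ y r →
  let P′ = con 1ℚ :+ (y :- y :* y)
      Q′ = (con 1ℚ :- P′ :* r) :+ y :* (r :* r)
      Δ′ = con 1ℚ :- (y :+ y) :- y :* y :- (y :* (y :* y) :+ y :* (y :* y)) :+ y :* (y :* (y :* y))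
      Y  = P′ :- y :* (r :+ r)
  in y :* ((Q′ :+ Q′) :+ (Q′ :+ Q′)) := Y :* Y :- Δ′) (λ _ → refl)
  where open SeriesSolver

-- Both correction terms vanish for r = r₂, R = r₂^j, p = r₂^(j−1), since R = r p and Q x r₂ = 0.
recurrence-identity : ∀ y r R p →
  (R ⊖ p) ⊖ (y ⊛ y) ≗
  ((y ⊛ (((r ⊛ R) ⊖ R) ⊕ (y ⊛ (R ⊖ constS 1ℚ)))) ⊕ ((R ⊖ (r ⊛ p)) ⊛ W y r)) ⊖ (p ⊛ Q y r)
recurrence-identity = solve 4 (λ y r R p →
  let P′ = con 1ℚ :+ (y :- y :* y)
      Q′ = (con 1ℚ :- P′ :* r) :+ y :* (r :* r)
      W′ = con 1ℚ :- y :* r :+ y :- y :* y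
  in R :- p :- y :* y := y :* (r :* R :- R :+ y :* (R :- con 1ℚ)) :+ (R :- r :* p) :* W′ :- p :* Q′)
  (λ _ → refl)
  where open SeriesSolver

numPoly-≗ : numPoly ≗ P x
numPoly-≗ n = trans (by-shifts n) (cong (λ z → constS 1ℚ n + (x n - z)) (sym (x-⊛ x n)))
  where
  by-shifts : numPoly ≗ constS 1ℚ ⊕ (x ⊖ shift x)
  by-shifts 0 = refl
  by-shifts 1 = refl
  by-shifts 2 = refl
  by-shifts (suc (suc (suc n))) = refl

discr-≗ : discr ≗ Δ x
discr-≗ n = trans (by-shifts n) (sym (cong₂ _+_
  (cong₂ _-_ (cong (_-_ (constS 1ℚ n - (x n + x n))) (x-⊛ x n)) (cong₂ _+_ (x³-shift n) (x³-shift n)))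
  (x⁴-shift n)))
  where
  by-shifts : discr ≗ (((constS 1ℚ ⊖ (x ⊕ x)) ⊖ shift x) ⊖ (shift (shift x) ⊕ shift (shift x))) ⊕ shift (shift (shift x))
  by-shifts 0 = refl
  by-shifts 1 = refl
  by-shifts 2 = refl
  by-shifts 3 = refl
  by-shifts 4 = refl
  by-shifts (suc (suc (suc (suc (suc n))))) = refl

sqrtS-discr-≗ : sqrtS discr ≗ P x ⊖ (x ⊛ (r₂ ⊕ r₂))
sqrtS-discr-≗ n = trans (from-r₂ n) (cong₂ _-_ (numPoly-≗ n) (sym (x-⊛ (r₂ ⊕ r₂) n)))
  where
  from-r₂ : sqrtS discr ≗ numPoly ⊖ shift (r₂ ⊕ r₂)
  from-r₂ zero    = refl
  from-r₂ (suc n) = solve 2 (λ a b → b := a :- (con ½ :* (a :- b) :+ con ½ :* (a :- b))) refl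
    (numPoly (suc n)) (sqrtS discr (suc n))
    where open +-*-Solver

quadruple-zero : ∀ a → (a + a) + (a + a) ≡ 0ℚ → a ≡ 0ℚ
quadruple-zero a 4a≡0 = trans (solve 1 (λ a → a := con ½ :* (con ½ :* ((a :+ a) :+ (a :+ a)))) refl a)
  (cong (λ z → ½ * (½ * z)) 4a≡0)
  where open +-*-Solver

-- P − 2x r₂ is √Δ, so x · 4Q vanishes, and (x ⊛ 4Q) (suc n) = 4Q n.
r₂-quadratic : Q x r₂ ≗ const 0ℚ
r₂-quadratic n = quadruple-zero (Q x r₂ n) (begin
  4Q n                              ≡⟨ x-⊛ 4Q (suc n) ⟨
  (x ⊛ 4Q) (suc n)                  ≡⟨ quadratic-discriminant x r₂ (suc n) ⟩
  (Y ⊛ Y) (suc n) - Δ x (suc n)     ≡⟨ cong₂ _-_ (⊛-cong Y≗s Y≗s (suc n)) (sym (discr-≗ (suc n))) ⟩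
  (s ⊛ s) (suc n) - discr (suc n)   ≡⟨ cong (_- discr (suc n)) (sqrtS-⊛ discr refl (suc n)) ⟩
  discr (suc n) - discr (suc n)     ≡⟨ +-inverseʳ (discr (suc n)) ⟩
  0ℚ                                ∎)
  where
  open ≡-Reasoning
  4Q = (Q x r₂ ⊕ Q x r₂) ⊕ (Q x r₂ ⊕ Q x r₂)
  s = sqrtS discr
  Y = P x ⊖ (x ⊛ (r₂ ⊕ r₂))
  Y≗s : Y ≗ s
  Y≗s n = sym (sqrtS-discr-≗ n)

-- r₂^(j − 1), in the form in which numer (−j) computes it.
r₂^pred : ℕ → Series
r₂^pred zero    = pow (inv1 r₂) 1
r₂^pred (suc j) = pow r₂ j

pow-r₂-≗ : ∀ j → pow r₂ j ≗ r₂ ⊛ r₂^pred j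
pow-r₂-≗ zero    n = sym (trans (⊛-cong {r₂} (λ _ → refl) (⊛-identityʳ (inv1 r₂)) n) (⊛-inv1 r₂ refl n))
pow-r₂-≗ (suc j) n = refl

N : ℕ → Series
N j = (pow r₂ j ⊖ r₂^pred j) ⊖ x²

M : ℕ → Series
M j = pow r₂ (suc j) ⊖ pow r₂ j

numer-≗-N : ∀ j → numer (ℤ.- (+ j)) ≗ N j
numer-≗-N zero          _ = refl
numer-≗-N (suc zero)    _ = refl
numer-≗-N (suc (suc j)) _ = refl

N-≗ : ∀ j → N j ≗ shift (M j ⊕ shift (pow r₂ j ⊖ oneS))
N-≗ j n = begin
  N j n
    ≡⟨ cong (λ z → (R n - p n) - z) (x²-≗ n) ⟩
  ((R ⊖ p) ⊖ (x ⊛ x)) n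
    ≡⟨ recurrence-identity x r₂ R p n ⟩
  (x ⊛ F) n + ((R ⊖ (r₂ ⊛ p)) ⊛ W x r₂) n - (p ⊛ Q x r₂) n
    ≡⟨ cong₂ (λ a b → (x ⊛ F) n + a - b) R-r₂p-vanishes pQ-vanishes ⟩
  (x ⊛ F) n + 0ℚ - 0ℚ
    ≡⟨ solve 1 (λ a → a :+ con 0ℚ :- con 0ℚ := a) refl ((x ⊛ F) n) ⟩
  (x ⊛ F) n
    ≡⟨ x-⊛ F n ⟩
  shift F n
    ≡⟨ shift-cong F≗ n ⟩
  shift (M j ⊕ shift (R ⊖ oneS)) n ∎
  where
  open ≡-Reasoning
  open +-*-Solver
  R = pow r₂ j
  p = r₂^pred j
  F = ((r₂ ⊛ R) ⊖ R) ⊕ (x ⊛ (R ⊖ constS 1ℚ))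
  F≗ : F ≗ M j ⊕ shift (R ⊖ oneS)
  F≗ m = cong (_+_ (M j m)) (trans (x-⊛ (R ⊖ constS 1ℚ) m) (shift-cong (λ k → cong (_-_ (R k)) (constS-1ℚ k)) m))
  R-r₂p-vanishes : ((R ⊖ (r₂ ⊛ p)) ⊛ W x r₂) n ≡ 0ℚ
  R-r₂p-vanishes = trans (⊛-cong {g = W x r₂} R≗r₂p (λ _ → refl) n) (⊛-zeroˡ (W x r₂) n)
    where
    R≗r₂p : R ⊖ (r₂ ⊛ p) ≗ const 0ℚ
    R≗r₂p m = trans (cong (_- (r₂ ⊛ p) m) (pow-r₂-≗ j m)) (+-inverseʳ ((r₂ ⊛ p) m))
  pQ-vanishes : (p ⊛ Q x r₂) n ≡ 0ℚ
  pQ-vanishes = trans (⊛-cong {p} (λ _ → refl) r₂-quadratic n) (⊛-zeroʳ p n)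

pow-r₂-telescope : ∀ j k → pow r₂ j k - oneS k ≡ sumTo j (λ i → M i k)
pow-r₂-telescope zero    k = +-inverseʳ (oneS k)
pow-r₂-telescope (suc j) k = begin
  pow r₂ (suc j) k - oneS k
    ≡⟨ solve 3 (λ a b c → a :- c := (a :- b) :+ (b :- c)) refl (pow r₂ (suc j) k) (pow r₂ j k) (oneS k) ⟩
  M j k + (pow r₂ j k - oneS k)
    ≡⟨ cong (_+_ (M j k)) (pow-r₂-telescope j k) ⟩
  M j k + sumTo j (λ i → M i k)
    ∎
  where
  open ≡-Reasoning
  open +-*-Solver

M-≗ : ∀ j → M j ≗ N (suc j) ⊕ x²
M-≗ j k = solve 2 (λ a b → a := (a :- b) :+ b) refl (M j k) (x² k)
  where open +-*-Solver

M-zero : ∀ j → M j 0 ≡ 0ℚ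
M-zero j = begin
  (r₂ ⊛ pow r₂ j) 0 - pow r₂ j 0       ≡⟨ cong (_- pow r₂ j 0) (⊛-zero r₂ (pow r₂ j)) ⟩
  1ℚ * pow r₂ j 0 - pow r₂ j 0         ≡⟨ solve 1 (λ a → con 1ℚ :* a :- a := con 0ℚ) refl (pow r₂ j 0) ⟩
  0ℚ                                   ∎
  where
  open ≡-Reasoning
  open +-*-Solver

N-zero : ∀ j → N j 0 ≡ 0ℚ
N-zero j = N-≗ j 0

N-one : ∀ j → N j 1 ≡ 0ℚ
N-one j = trans (N-≗ j 1) (trans (+-identityʳ (M j 0)) (M-zero j))

N-suc-suc : ∀ j k → N j (suc (suc k)) ≡ M j (suc k) + sumTo j (λ i → M i k)
N-suc-suc j k = trans (N-≗ j (suc (suc k))) (cong (_+_ (M j (suc k))) (pow-r₂-telescope j k))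

M-one : ∀ j → M j 1 ≡ 0ℚ
M-one j = trans (M-≗ j 1) (trans (+-identityʳ (N (suc j) 1)) (N-one (suc j)))

N-two : ∀ j → N j 2 ≡ 0ℚ
N-two j = begin
  N j 2                                       ≡⟨ N-≗ j 2 ⟩
  M j 1 + (pow r₂ j 0 - 1ℚ)                   ≡⟨ cong₂ (λ a b → a + (b - 1ℚ)) (M-one j) (pow-constant r₂ refl j) ⟩
  0ℚ + (1ℚ - 1ℚ)                              ≡⟨⟩
  0ℚ                                          ∎
  where open ≡-Reasoning

M-two : ∀ j → M j 2 ≡ 1ℚ
M-two j = trans (M-≗ j 2) (cong (_+ 1ℚ) (N-two (suc j)))

-- Walks above a floor
noConsecDown-D : ∀ {k l} p → NoConsecDown (D k ∷ p) → NoConsecDown (D l ∷ p)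
noConsecDown-D []          _   = tt
noConsecDown-D (U ∷ p)     ncd = ncd
noConsecDown-D (D _ ∷ p)   ()

noConsecDown-++⁻ˡ : ∀ p {q} → NoConsecDown (p ++ q) → NoConsecDown p
noConsecDown-++⁻ˡ []                _   = tt
noConsecDown-++⁻ˡ (U ∷ p)           ncd = noConsecDown-++⁻ˡ p ncd
noConsecDown-++⁻ˡ (D k ∷ [])        _   = tt
noConsecDown-++⁻ˡ (D k ∷ U ∷ p)     ncd = noConsecDown-++⁻ˡ (U ∷ p) ncd
noConsecDown-++⁻ˡ (D k ∷ D l ∷ p)   ()

noConsecDown-++U : ∀ p {q} → NoConsecDown p → NoConsecDown (U ∷ q) → NoConsecDown (p ++ U ∷ q)
noConsecDown-++U []                _   ncd = ncd
noConsecDown-++U (U ∷ p)           ncd ncd′ = noConsecDown-++U p ncd ncd′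
noConsecDown-++U (D k ∷ [])        _   ncd′ = ncd′
noConsecDown-++U (D k ∷ U ∷ p)     ncd ncd′ = noConsecDown-++U (U ∷ p) ncd ncd′
noConsecDown-++U (D k ∷ D l ∷ p)   ()

noConsecDown-replicate-U : ∀ k → NoConsecDown (replicate k U)
noConsecDown-replicate-U zero    = tt
noConsecDown-replicate-U (suc k) = noConsecDown-replicate-U k

height-++ : ∀ p q → height (p ++ q) ≡ height p ℤ.+ height q
height-++ []      q = sym (ℤ.+-identityˡ (height q))
height-++ (s ∷ p) q = trans (cong (ℤ._+_ (δ s)) (height-++ p q)) (sym (ℤ.+-assoc (δ s) (height p) (height q)))

height-replicate-U : ∀ k → height (replicate k U) ≡ + k
height-replicate-U zero    = refl
height-replicate-U (suc k) = cong (ℤ._+_ (+ 1)) (height-replicate-U k)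

height-UD : ∀ k → height (U ∷ D (suc k) ∷ []) ≡ ℤ.- (+ k)
height-UD zero    = refl
height-UD (suc k) = refl

isPartialGDAP⁻ : ∀ p → IsPartialGDAP p → All ValidStep p × NoConsecDown p
isPartialGDAP⁻ p (_ , valid , ncd , _) = All.++⁻ˡ p valid , noConsecDown-++⁻ˡ p ncd

-- A path ending at height k ≥ 0 is completed by U D_{k+1}, one ending at -(k+1) by U^{k+1}.
isPartialGDAP⁺ : ∀ p → All ValidStep p → NoConsecDown p → IsPartialGDAP p
isPartialGDAP⁺ p valid ncd with height p in eq
... | + k      = U ∷ D (suc k) ∷ [] , All.++⁺ valid (tt ∷ s≤s z≤n ∷ []) , noConsecDown-++U p ncd tt , (begin
  height (p ++ U ∷ D (suc k) ∷ [])           ≡⟨ height-++ p _ ⟩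
  height p ℤ.+ height (U ∷ D (suc k) ∷ [])   ≡⟨ cong₂ ℤ._+_ eq (height-UD k) ⟩
  + k ℤ.+ ℤ.- (+ k)                          ≡⟨ ℤ.+-inverseʳ (+ k) ⟩
  + 0                                        ∎)
  where open ≡-Reasoning
... | -[1+ k ] = replicate (suc k) U , All.++⁺ valid (All.replicate⁺ (suc k) tt) ,
  noConsecDown-++U p ncd (noConsecDown-replicate-U k) , (begin
  height (p ++ replicate (suc k) U)             ≡⟨ height-++ p _ ⟩
  height p ℤ.+ height (replicate (suc k) U)     ≡⟨ cong₂ ℤ._+_ eq (height-replicate-U (suc k)) ⟩
  -[1+ k ] ℤ.+ + suc k                          ≡⟨ ℤ.+-inverseˡ (+ suc k) ⟩
  + 0                                           ∎)
  where open ≡-Reasoning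

-- The flag records whether the step before p was a down step; NoConsecDown (D 1 ∷ p) says p may follow one.
NoConsecDownAfter : Bool → List Step → Set
NoConsecDownAfter false p = NoConsecDown p
NoConsecDownAfter true  p = NoConsecDown (D 1 ∷ p)

U-after : ∀ b {p} → NoConsecDown p → NoConsecDownAfter b (U ∷ p)
U-after false = id
U-after true  = id

U-after⁻ : ∀ b {p} → NoConsecDownAfter b (U ∷ p) → NoConsecDown p
U-after⁻ false = id
U-after⁻ true  = id

Walk : Bool → ℕ → List Step → Set
Walk _     d []        = ⊤
Walk _     d (U ∷ p)   = Walk false (suc d) p
Walk false d (D k ∷ p) = 1 ℕ.≤ k × k ℕ.≤ d × Walk true (d ∸ k) p
Walk true  d (D k ∷ p) = ⊥

height-U : ∀ m d → m ℤ.+ + d ℤ.+ δ U ≡ m ℤ.+ + suc d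
height-U m d = trans (ℤ.+-assoc m (+ d) (+ 1)) (cong (λ n → m ℤ.+ + n) (ℕ.+-comm d 1))

height-D : ∀ m d k → m ℤ.+ + d ℤ.+ δ (D k) ≡ m ℤ.+ (d ℤ.⊖ k)
height-D m d k = trans (ℤ.+-assoc m (+ d) (ℤ.- + k)) (cong (ℤ._+_ m) (ℤ.m-n≡m⊖n d k))

height-D-≤ : ∀ m {d k} → k ℕ.≤ d → m ℤ.+ + d ℤ.+ δ (D k) ≡ m ℤ.+ + (d ∸ k)
height-D-≤ m {d} {k} k≤d = trans (height-D m d k) (cong (ℤ._+_ m) (ℤ.⊖-≥ k≤d))

above-floor⇒≤ : ∀ m d k → m ℤ.≤ m ℤ.+ (d ℤ.⊖ k) → k ℕ.≤ d
above-floor⇒≤ m d k m≤ with k ℕ.≤? d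
... | yes k≤d = k≤d
... | no  k≰d = contradiction m≤ (ℤ.<⇒≱ below)
  where
  d<k = ℕ.≰⇒> k≰d
  d⊖k<0 : d ℤ.⊖ k ℤ.< + 0
  d⊖k<0 = subst (ℤ._< + 0) (sym (ℤ.⊖-< d<k)) (ℤ.neg-mono-< (+<+ (ℕ.m<n⇒0<n∸m d<k)))
  below : m ℤ.+ (d ℤ.⊖ k) ℤ.< m
  below = subst (m ℤ.+ (d ℤ.⊖ k) ℤ.<_) (ℤ.+-identityʳ m) (ℤ.+-monoʳ-< m d⊖k<0)

NeverBelowFrom-head : ∀ {m h} p → NeverBelowFrom m h p → m ℤ.≤ h
NeverBelowFrom-head []      m≤h       = m≤h
NeverBelowFrom-head (_ ∷ _) (m≤h , _) = m≤h

walk⇒ : ∀ m b d p → Walk b d p → All ValidStep p × NoConsecDownAfter b p × NeverBelowFrom m (m ℤ.+ + d) p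
walk⇒ m false d [] _ = [] , tt , ℤ.i≤i+j m (+ d)
walk⇒ m true  d [] _ = [] , tt , ℤ.i≤i+j m (+ d)
walk⇒ m b d (U ∷ p) w with walk⇒ m false (suc d) p w
... | valid , ncd , above = tt ∷ valid , U-after b ncd ,
  ℤ.i≤i+j m (+ d) , subst (λ h → NeverBelowFrom m h p) (sym (height-U m d)) above
walk⇒ m false d (D k ∷ p) (1≤k , k≤d , w) with walk⇒ m true (d ∸ k) p w
... | valid , ncd , above = 1≤k ∷ valid , noConsecDown-D p ncd ,
  ℤ.i≤i+j m (+ d) , subst (λ h → NeverBelowFrom m h p) (sym (height-D-≤ m k≤d)) above

walk⇐ : ∀ m b d p → All ValidStep p → NoConsecDownAfter b p → NeverBelowFrom m (m ℤ.+ + d) p → Walk b d p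
walk⇐ m b d [] _ _ _ = tt
walk⇐ m b d (U ∷ p) (_ ∷ valid) ncd (_ , above) =
  walk⇐ m false (suc d) p valid (U-after⁻ b ncd) (subst (λ h → NeverBelowFrom m h p) (height-U m d) above)
walk⇐ m false d (D k ∷ p) (1≤k ∷ valid) ncd (_ , above) =
  1≤k , k≤d , walk⇐ m true (d ∸ k) p valid (noConsecDown-D p ncd) (subst (λ h → NeverBelowFrom m h p) (height-D-≤ m k≤d) above)
  where
  k≤d = above-floor⇒≤ m d k (subst (m ℤ.≤_) (height-D m d k) (NeverBelowFrom-head p above))
walk⇐ m true d (D k ∷ p) _ () _

mutual
  walks : Bool → ℕ → ℕ → List (List Step)
  walks _     d zero    = [ [] ]
  walks false d (suc n) = map (U ∷_) (walks false (suc d) n) ++ descents d n d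
  walks true  d (suc n) = map (U ∷_) (walks false (suc d) n)

  -- the walks of length suc n from d whose first step goes down to some i < c
  descents : ℕ → ℕ → ℕ → List (List Step)
  descents d n zero    = []
  descents d n (suc i) = map (D (d ∸ i) ∷_) (walks true i n) ++ descents d n i

∈-descents⁺ : ∀ {d n c i q} → i ℕ.< c → q ∈ walks true i n → D (d ∸ i) ∷ q ∈ descents d n c
∈-descents⁺ {d} {n} {suc c} {i} {q} (s≤s i≤c) q∈ with ℕ.m≤n⇒m<n∨m≡n i≤c
... | inj₂ refl = ∈-++⁺ˡ (∈-map⁺ (D (d ∸ i) ∷_) q∈)
... | inj₁ i<c  = ∈-++⁺ʳ (map (D (d ∸ c) ∷_) (walks true c n)) (∈-descents⁺ i<c q∈)

∈-descents⁻ : ∀ d n c {p} → p ∈ descents d n c →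
  Σ ℕ λ i → Σ (List Step) λ q → i ℕ.< c × p ≡ D (d ∸ i) ∷ q × q ∈ walks true i n
∈-descents⁻ d n (suc c) p∈ with ∈-++⁻ (map (D (d ∸ c) ∷_) (walks true c n)) p∈
... | inj₁ p∈map with ∈-map⁻ (D (d ∸ c) ∷_) p∈map
...   | q , q∈ , refl = c , q , ℕ.≤-refl , refl , q∈
∈-descents⁻ d n (suc c) p∈ | inj₂ p∈rest with ∈-descents⁻ d n c p∈rest
... | i , q , i<c , refl , q∈ = i , q , ℕ.m≤n⇒m≤1+n i<c , refl , q∈

walks-sound : ∀ b d n {p} → p ∈ walks b d n → Walk b d p × length p ≡ n
walks-sound b d zero (here refl) = tt , refl
walks-sound false d (suc n) p∈ with ∈-++⁻ (map (U ∷_) (walks false (suc d) n)) p∈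
... | inj₁ p∈ups with ∈-map⁻ (U ∷_) p∈ups
...   | q , q∈ , refl with walks-sound false (suc d) n q∈
...     | w , len = w , cong suc len
walks-sound false d (suc n) p∈ | inj₂ p∈descents with ∈-descents⁻ d n d p∈descents
... | i , q , i<d , refl , q∈ with walks-sound true i n q∈
...   | w , len =
  (ℕ.m<n⇒0<n∸m i<d , ℕ.m∸n≤m d i , subst (λ e → Walk true e q) (sym (ℕ.m∸[m∸n]≡n (ℕ.<⇒≤ i<d))) w) , cong suc len
walks-sound true d (suc n) p∈ with ∈-map⁻ (U ∷_) p∈
... | q , q∈ , refl with walks-sound false (suc d) n q∈
...   | w , len = w , cong suc len

walks-complete : ∀ b d p → Walk b d p → p ∈ walks b d (length p)
walks-complete b     d []        _ = here refl
walks-complete false d (U ∷ p)   w = ∈-++⁺ˡ (∈-map⁺ (U ∷_) (walks-complete false (suc d) p w))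
walks-complete true  d (U ∷ p)   w = ∈-map⁺ (U ∷_) (walks-complete false (suc d) p w)
walks-complete false d (D k ∷ p) (1≤k , k≤d , w) =
  ∈-++⁺ʳ (map (U ∷_) (walks false (suc d) (length p)))
    (subst (λ l → D l ∷ p ∈ descents d (length p) d) (ℕ.m∸[m∸n]≡n k≤d)
      (∈-descents⁺ (ℕ.∸-monoʳ-< 1≤k k≤d) (walks-complete true (d ∸ k) p w)))

D-injective : ∀ {k l} → D k ≡ D l → k ≡ l
D-injective refl = refl

mutual
  walks-unique : ∀ b d n → Unique (walks b d n)
  walks-unique _     d zero    = [] ∷ []
  walks-unique false d (suc n) = Unique.++⁺ (Unique.map⁺ ∷-injectiveʳ (walks-unique false (suc d) n))
    (descents-unique d n d ℕ.≤-refl) disjoint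
    where
    disjoint : ∀ {p} → p ∈ map (U ∷_) (walks false (suc d) n) × p ∈ descents d n d → ⊥
    disjoint (p∈ups , p∈descents) with ∈-map⁻ (U ∷_) p∈ups | ∈-descents⁻ d n d p∈descents
    ... | _ , _ , refl | _ , _ , _ , () , _
  walks-unique true  d (suc n) = Unique.map⁺ ∷-injectiveʳ (walks-unique false (suc d) n)

  descents-unique : ∀ d n c → c ℕ.≤ d → Unique (descents d n c)
  descents-unique d n zero    _   = []
  descents-unique d n (suc c) c<d = Unique.++⁺ (Unique.map⁺ ∷-injectiveʳ (walks-unique true c n))
    (descents-unique d n c (ℕ.<⇒≤ c<d)) disjoint
    where
    disjoint : ∀ {p} → p ∈ map (D (d ∸ c) ∷_) (walks true c n) × p ∈ descents d n c → ⊥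
    disjoint (p∈first , p∈rest) with ∈-map⁻ (D (d ∸ c) ∷_) p∈first | ∈-descents⁻ d n c p∈rest
    ... | _ , _ , refl | i , _ , i<c , eq , _ =
      ℕ.<-irrefl (D-injective (∷-injectiveˡ eq)) (ℕ.∸-monoʳ-< i<c (ℕ.<⇒≤ c<d))

-- Counting
ℕtoℚ-+ : ∀ a b → ℕtoℚ (a ℕ.+ b) ≡ ℕtoℚ a + ℕtoℚ b
ℕtoℚ-+ a b = sym (begin
  ℕtoℚ a + ℕtoℚ b
    ≡⟨ cong₂ _+_ (as-mkℚ a) (as-mkℚ b) ⟩
  (+ a ℤ.* + 1 ℤ.+ + b ℤ.* + 1) ℚ./ 1
    ≡⟨ cong₂ (λ u v → (u ℤ.+ v) ℚ./ 1) (ℤ.*-identityʳ (+ a)) (ℤ.*-identityʳ (+ b)) ⟩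
  ℕtoℚ (a ℕ.+ b)
    ∎)
  where
  open ≡-Reasoning
  as-mkℚ : ∀ c → ℕtoℚ c ≡ ℚ.mkℚ (+ c) 0 (Coprime.sym (Coprime.1-coprimeTo c))
  as-mkℚ c = normalize-coprime (Coprime.sym (Coprime.1-coprimeTo c))

#walks : Bool → ℕ → ℕ → ℚ
#walks b d n = ℕtoℚ (length (walks b d n))

#descents : ∀ d n c → ℕtoℚ (length (descents d n c)) ≡ sumTo c (λ i → #walks true i n)
#descents d n zero    = refl
#descents d n (suc c) = begin
  ℕtoℚ (length (map (D (d ∸ c) ∷_) (walks true c n) ++ descents d n c))
    ≡⟨ cong ℕtoℚ (length-++ (map (D (d ∸ c) ∷_) (walks true c n))) ⟩
  ℕtoℚ (length (map (D (d ∸ c) ∷_) (walks true c n)) ℕ.+ length (descents d n c))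
    ≡⟨ ℕtoℚ-+ (length (map (D (d ∸ c) ∷_) (walks true c n))) (length (descents d n c)) ⟩
  ℕtoℚ (length (map (D (d ∸ c) ∷_) (walks true c n))) + ℕtoℚ (length (descents d n c))
    ≡⟨ cong₂ _+_ (cong ℕtoℚ (length-map (D (d ∸ c) ∷_) (walks true c n))) (#descents d n c) ⟩
  #walks true c n + sumTo c (λ i → #walks true i n) ∎
  where open ≡-Reasoning

#walks-true-suc : ∀ d n → #walks true d (suc n) ≡ #walks false (suc d) n
#walks-true-suc d n = cong ℕtoℚ (length-map (U ∷_) (walks false (suc d) n))

#walks-false-suc : ∀ d n → #walks false d (suc n) ≡ #walks false (suc d) n + sumTo d (λ i → #walks true i n)
#walks-false-suc d n = begin
  ℕtoℚ (length (map (U ∷_) (walks false (suc d) n) ++ descents d n d))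
    ≡⟨ cong ℕtoℚ (length-++ (map (U ∷_) (walks false (suc d) n))) ⟩
  ℕtoℚ (length (map (U ∷_) (walks false (suc d) n)) ℕ.+ length (descents d n d))
    ≡⟨ ℕtoℚ-+ (length (map (U ∷_) (walks false (suc d) n))) (length (descents d n d)) ⟩
  #walks true d (suc n) + ℕtoℚ (length (descents d n d))
    ≡⟨ cong₂ _+_ (#walks-true-suc d n) (#descents d n d) ⟩
  #walks false (suc d) n + sumTo d (λ i → #walks true i n) ∎
  where open ≡-Reasoning

coefficients : ∀ n j → N j (3 ℕ.+ n) ≡ #walks false j n × M j (2 ℕ.+ n) ≡ #walks true j n
coefficients zero    j = N-three , M-two j
  where
  N-three : N j 3 ≡ 1ℚ
  N-three = begin
    N j 3                                   ≡⟨ N-suc-suc j 1 ⟩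
    M j 2 + sumTo j (λ i → M i 1)           ≡⟨ cong₂ _+_ (M-two j) (trans (sumTo-cong j (λ i _ → M-one i)) (sumTo-0 j)) ⟩
    1ℚ + 0ℚ                                 ≡⟨⟩
    1ℚ                                      ∎
    where open ≡-Reasoning
coefficients (suc n) j = N-coefficient , trans M-coefficient (sym (#walks-true-suc j n))
  where
  M-coefficient : M j (3 ℕ.+ n) ≡ #walks false (suc j) n
  M-coefficient = trans (M-≗ j (3 ℕ.+ n)) (trans (+-identityʳ _) (proj₁ (coefficients n (suc j))))

  N-coefficient : N j (4 ℕ.+ n) ≡ #walks false j (suc n)
  N-coefficient = begin
    N j (4 ℕ.+ n)
      ≡⟨ N-suc-suc j (2 ℕ.+ n) ⟩
    M j (3 ℕ.+ n) + sumTo j (λ i → M i (2 ℕ.+ n))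
      ≡⟨ cong₂ _+_ M-coefficient (sumTo-cong j (λ i _ → proj₂ (coefficients n i))) ⟩
    #walks false (suc j) n + sumTo j (λ i → #walks true i n)
      ≡⟨ #walks-false-suc j n ⟨
    #walks false j (suc n)
      ∎
    where open ≡-Reasoning

partialGDAP-HasCard : ∀ j n →
  HasCard (λ p → IsPartialGDAP p × NeverBelow (ℤ.- (+ j)) p × length p ≡ n) (length (walks false j n))
partialGDAP-HasCard j n = walks false j n , walks-unique false j n , (λ p → sound , complete p) , refl
  where
  floor = ℤ.- (+ j)

  start : floor ℤ.+ + j ≡ + 0
  start = ℤ.+-inverseˡ (+ j)

  sound : ∀ {p} → p ∈ walks false j n → IsPartialGDAP p × NeverBelow floor p × length p ≡ n
  sound {p} p∈ with walks-sound false j n p∈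
  ... | w , len with walk⇒ floor false j p w
  ...   | valid , ncd , above = isPartialGDAP⁺ p valid ncd , subst (λ h → NeverBelowFrom floor h p) start above , len

  complete : ∀ p → IsPartialGDAP p × NeverBelow floor p × length p ≡ n → p ∈ walks false j n
  complete p (partial , above , refl) with isPartialGDAP⁻ p partial
  ... | valid , ncd =
    walks-complete false j p (walk⇐ floor false j p valid ncd (subst (λ h → NeverBelowFrom floor h p) (sym start) above))

numer-coefficients : ∀ j →
    (numer (ℤ.- (+ j)) 0 ≡ 0ℚ × numer (ℤ.- (+ j)) 1 ≡ 0ℚ × numer (ℤ.- (+ j)) 2 ≡ 0ℚ) ×
    ((n : ℕ) → Σ ℕ (λ c →
      HasCard (λ (p : List Step) → IsPartialGDAP p × NeverBelow (ℤ.- (+ j)) p × length p ≡ n) c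
      × numer (ℤ.- (+ j)) (3 ℕ.+ n) ≡ ℕtoℚ c))
numer-coefficients j =
  (trans (numer-≗-N j 0) (N-zero j) , trans (numer-≗-N j 1) (N-one j) , trans (numer-≗-N j 2) (N-two j)) ,
  λ n → length (walks false j n) , partialGDAP-HasCard j n , trans (numer-≗-N j (3 ℕ.+ n)) (proj₁ (coefficients n j))

theorem3 : (m : ℤ) → m ≤ + 0 →
    (numer m 0 ≡ 0ℚ × numer m 1 ≡ 0ℚ × numer m 2 ≡ 0ℚ) ×
    ((n : ℕ) → Σ ℕ (λ c →
      HasCard (λ (p : List Step) → IsPartialGDAP p × NeverBelow m p × length p ≡ n) c
      × numer m (3 Data.Nat.+ n) ≡ ℕtoℚ c))
theorem3 (+ zero)  _        = numer-coefficients 0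
theorem3 (+ suc _) (+≤+ ())
theorem3 -[1+ k ]  _        = numer-coefficients (suc k)
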